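{- Let $T$ be a tree on $n$ vertices, let $x$ be a leaf of $T$, and let $\Delta \geq 2$. Then $|(T-x)_\Delta| \geq |T_\Delta| - 1$.
   Context: For a tree $S$ on $N$ vertices, a vertex $x$ and an edge $e$ incident to $x$, the weight $w_e(x)$ is the number of vertices $y$ of $S$ for which $e$ is the first edge of the path in $S$ from $x$ to $y$. For $\Delta \ge 2$, a vertex $x$ of $S$ is $\Delta$-core if every edge $e$ incident to $x$ has $w_e(x) \leq (1-1/\Delta)N$. The core tree $S_\Delta$ is the subgraph of $S$ induced by the $\Delta$-core vertices of $S$. Here $(T-x)_\Delta$ is the core tree of the tree $T-x$ (on $n-1$ vertices). -}

module Defs where

open import Data.Nat using (ℕ; zero; suc; _*_; _∸_; _≤_)
open import Data.Fin using (Fin; punchIn)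
open import Data.Fin.Subset using (Subset; _∈_; ∣_∣)
open import Data.List using (List; []; _∷_)
open import Data.List.Relation.Unary.Unique.Propositional using (Unique)
open import Data.Product using (Σ; _×_; ∃)
open import Function.Bundles using (_⇔_)
open import Relation.Nullary using (¬_)
open import Relation.Binary.PropositionalEquality using (_≡_)
open import Data.Empty using (⊥)

record Graph (n : ℕ) : Set₁ where
  field
    Adj    : Fin n → Fin n → Set
    sym    : ∀ {u v} → Adj u v → Adj v u
    irrefl : ∀ {u} → ¬ Adj u u
open Graph public

data Walk {n : ℕ} (G : Graph n) : Fin n → Fin n → Set where
  nil  : ∀ {u} → Walk G u u
  cons : ∀ {u v w} → Adj G u v → Walk G v w → Walk G u w

verts : ∀ {n} {G : Graph n} {u v} → Walk G u v → List (Fin n)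
verts {u = u} nil        = u ∷ []
verts {u = u} (cons _ p) = u ∷ verts p

len : ∀ {n} {G : Graph n} {u v} → Walk G u v → ℕ
len nil        = 0
len (cons _ p) = suc (len p)

IsPath : ∀ {n} {G : Graph n} {u v} → Walk G u v → Set
IsPath p = Unique (verts p)

Connected : ∀ {n} → Graph n → Set
Connected G = ∀ u v → Σ (Walk G u v) IsPath

-- No cycle: there is no edge uv together with a path from v back to u of
-- length ≥ 2 (which together would form a cycle of length ≥ 3).
Acyclic : ∀ {n} → Graph n → Set
Acyclic G = ∀ {u v} → Adj G u v → (p : Walk G v u) → IsPath p → len p ≤ 1

IsTree : ∀ {n} → Graph n → Set
IsTree G = Connected G × Acyclic G

Card : ∀ {n} → (Fin n → Set) → ℕ → Set
Card {n} P k = Σ (Subset n) λ S → (∀ z → (z ∈ S) ⇔ P z) × (∣ S ∣ ≡ k)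

FirstEdge : ∀ {n} (G : Graph n) (x y z : Fin n) → Set
FirstEdge G x y z = Σ (Walk G x z) λ p → IsPath p × StartsWith p
  where
  StartsWith : Walk G x z → Set
  StartsWith nil = ⊥
  StartsWith (cons {v = v} _ _) = v ≡ y

-- x is Δ-core in a graph on N vertices: every edge e = xy has
-- w_e(x) ≤ (1 - 1/Δ) N, i.e. Δ · w_e(x) ≤ (Δ - 1) · N.
IsCore : ∀ {N} (Δ : ℕ) (G : Graph N) (x : Fin N) → Set
IsCore {N} Δ G x = ∀ y → Adj G x y → ∀ w → Card (FirstEdge G x y) w → Δ * w ≤ (Δ ∸ 1) * N

IsLeaf : ∀ {n} (G : Graph n) (x : Fin n) → Set
IsLeaf G x = Card (Adj G x) 1

deleteVertex : ∀ {m} (G : Graph (suc m)) (x : Fin (suc m)) → Graph m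
deleteVertex G x = record
  { Adj    = λ i j → Adj G (punchIn x i) (punchIn x j)
  ; sym    = sym G
  ; irrefl = irrefl G
  }

-- Call a branch of T at v (the vertices behind one edge at v) heavy if it avoids the
-- leaf x and has more than (1 − 1/Δ)(n − 1) vertices. Branches avoiding x keep their
-- weight in T − x, so a Δ-core vertex v ≠ x of T that is not Δ-core in T − x has a
-- heavy branch: a violating branch through x would already violate the bound in T.
-- No two core vertices of T can both be x or have a heavy branch. If x is one of
-- them, the branch at x towards v strictly contains v's heavy branch. For two vertices
-- with heavy branches, either one lies strictly inside the branch at the other vertex
-- pointing back, or the two are disjoint and too large together, or they face each
-- other and cover T while missing x. So at most one Δ-core vertex is lost.

module Submission where

open import Defs hiding (sym)
open import Data.Nat using (ℕ; suc; _≤_; _∸_)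
open import Data.Fin using (Fin)
open import Data.Product using (_,_)
open import Relation.Binary.PropositionalEquality using (refl)

module SubsetSize where

  open import Data.Bool.Properties using (T-≡)
  open import Data.Nat using (_+_; _<_; z≤n; s≤s)
  open import Data.Nat.Properties
    using (module ≤-Reasoning; ≤-trans; ≤-<-trans; n≤1+n; m≤n⇒m≤1+n; +-suc; +-monoʳ-≤;
           m≤o∸n⇒m+n≤o)
  open import Data.Fin using (zero; suc; _≟_; punchIn; punchOut)
  open import Data.Fin.Properties using (punchIn-punchOut; any?)
  open import Data.Fin.Subset
  open import Data.Fin.Subset.Properties
  open import Data.Sum using (inj₁; inj₂)
  open import Data.Vec using ([]; _∷_; lookup; insertAt; tabulate)
  open import Data.Vec.Properties
    using ([]=⇒lookup; lookup⇒[]=; lookup∘tabulate; tabulate∘lookup; tabulate-cong;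
           insertAt-lookup; insertAt-punchIn)
  open import Function using (_∘_)
  open import Function.Bundles using (_⇔_; mk⇔; Equivalence)
  open import Relation.Nullary using (yes; no; contradiction)
  open import Relation.Nullary.Decidable
    using (decidable-stable; isYes; toWitness; fromWitness; ¬?; _×-dec_)
  open import Relation.Unary using (Decidable)
  open import Relation.Binary.PropositionalEquality
    using (_≡_; sym; trans; cong; subst; module ≡-Reasoning)

  open Equivalence using (to; from)

  private variable
    n : ℕ
    p q : Subset n
    x y : Fin n

  subsetOf : {P : Fin n → Set} → Decidable P → Subset n
  subsetOf P? = tabulate (isYes ∘ P?)

  ∈-subsetOf : {P : Fin n → Set} (P? : Decidable P) → x ∈ subsetOf P? ⇔ P x
  ∈-subsetOf {x = x} P? = mk⇔
    (λ x∈ → toWitness {a? = P? x} (from T-≡ (trans (sym (lookup∘tabulate _ x)) ([]=⇒lookup x∈))))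
    (λ Px → lookup⇒[]= x _ (trans (lookup∘tabulate _ x) (to T-≡ (fromWitness Px))))

  Card-subsetOf : {P : Fin n → Set} (P? : Decidable P) → Card P ∣ subsetOf P? ∣
  Card-subsetOf P? = subsetOf P? , (λ _ → ∈-subsetOf P?) , refl

  ∈-ext : (∀ x → x ∈ p ⇔ x ∈ q) → p ≡ q
  ∈-ext p≈q = ⊆-antisym (to (p≈q _)) (from (p≈q _))

  Card-unique : ∀ {P : Fin n → Set} {k k′} → Card P k → Card P k′ → k ≡ k′
  Card-unique (p , ∈p , refl) (q , ∈q , refl) =
    cong ∣_∣ (∈-ext (λ x → mk⇔ (from (∈q x) ∘ to (∈p x)) (from (∈p x) ∘ to (∈q x))))

  ∣p∣≡1⇒∈-unique : ∣ p ∣ ≡ 1 → x ∈ p → y ∈ p → x ≡ y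
  ∣p∣≡1⇒∈-unique {p = p} {x = x} {y = y} ∣p∣≡1 x∈p y∈p with x ≟ y
  ... | yes x≡y = x≡y
  ... | no  x≢y =
    contradiction (subst (1 <_) ∣p∣≡1 (≤-<-trans 1≤∣p-x∣ (x∈p⇒∣p-x∣<∣p∣ x∈p))) λ { (s≤s ()) }
    where
    ⁅y⁆⊆p-x : ⁅ y ⁆ ⊆ p - x
    ⁅y⁆⊆p-x z∈⁅y⁆ rewrite x∈⁅y⁆⇒x≡y y z∈⁅y⁆ = x∈p∧x≢y⇒x∈p-y y∈p (x≢y ∘ sym)
    1≤∣p-x∣ : 1 ≤ ∣ p - x ∣
    1≤∣p-x∣ = subst (_≤ ∣ p - x ∣) (∣⁅x⁆∣≡1 y) (p⊆q⇒∣p∣≤∣q∣ ⁅y⁆⊆p-x)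

  ∣p∪q∣≤∣p∣+∣q∣ : ∀ (p q : Subset n) → ∣ p ∪ q ∣ ≤ ∣ p ∣ + ∣ q ∣
  ∣p∪q∣≤∣p∣+∣q∣ []            []            = z≤n
  ∣p∪q∣≤∣p∣+∣q∣ (inside  ∷ p) (inside  ∷ q) =
    s≤s (≤-trans (∣p∪q∣≤∣p∣+∣q∣ p q) (+-monoʳ-≤ ∣ p ∣ (n≤1+n ∣ q ∣)))
  ∣p∪q∣≤∣p∣+∣q∣ (inside  ∷ p) (outside ∷ q) = s≤s (∣p∪q∣≤∣p∣+∣q∣ p q)
  ∣p∪q∣≤∣p∣+∣q∣ (outside ∷ p) (inside  ∷ q) =
    subst (suc ∣ p ∪ q ∣ ≤_) (sym (+-suc ∣ p ∣ ∣ q ∣)) (s≤s (∣p∪q∣≤∣p∣+∣q∣ p q))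
  ∣p∪q∣≤∣p∣+∣q∣ (outside ∷ p) (outside ∷ q) = ∣p∪q∣≤∣p∣+∣q∣ p q

  ∣p∣≤1+∣q∣ : (∀ {x y} → x ∈ p → y ∈ p → x ∉ q → y ∉ q → x ≡ y) → ∣ p ∣ ≤ suc ∣ q ∣
  ∣p∣≤1+∣q∣ {p = p} {q = q} p∖q-subsingleton with any? (λ x → x ∈? p ×-dec ¬? (x ∈? q))
  ... | yes (x , x∈p , x∉q) = begin
    ∣ p ∣             ≤⟨ p⊆q⇒∣p∣≤∣q∣ p⊆⁅x⁆∪q ⟩
    ∣ ⁅ x ⁆ ∪ q ∣     ≤⟨ ∣p∪q∣≤∣p∣+∣q∣ ⁅ x ⁆ q ⟩
    ∣ ⁅ x ⁆ ∣ + ∣ q ∣ ≡⟨ cong (_+ ∣ q ∣) (∣⁅x⁆∣≡1 x) ⟩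
    suc ∣ q ∣         ∎
    where
    open ≤-Reasoning
    p⊆⁅x⁆∪q : p ⊆ ⁅ x ⁆ ∪ q
    p⊆⁅x⁆∪q {y} y∈p with y ∈? q
    ... | yes y∈q = x∈p∪q⁺ (inj₂ y∈q)
    ... | no  y∉q = x∈p∪q⁺ (inj₁ (subst (_∈ ⁅ x ⁆) (p∖q-subsingleton x∈p y∈p x∉q y∉q) (x∈⁅x⁆ x)))
  ... | no ∄x∈p∖q = m≤n⇒m≤1+n (p⊆q⇒∣p∣≤∣q∣ λ {y} y∈p →
    decidable-stable (y ∈? q) (λ y∉q → ∄x∈p∖q (y , y∈p , y∉q)))

  disjoint⇒∣q∣+∣p∣<n : {x : Fin n} {p q : Subset n} →
                       x ∉ p → x ∉ q → (∀ {y} → y ∈ p → y ∉ q) → ∣ q ∣ + ∣ p ∣ < n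
  disjoint⇒∣q∣+∣p∣<n {x = x} {p = p} {q = q} x∉p x∉q disjoint =
    m≤o∸n⇒m+n≤o (suc ∣ q ∣) (∣p∣≤n p) (begin-strict
      ∣ q ∣         ≤⟨ p⊆q⇒∣p∣≤∣q∣ q⊆∁p-x ⟩
      ∣ ∁ p - x ∣   <⟨ x∈p⇒∣p-x∣<∣p∣ (x∉p⇒x∈∁p x∉p) ⟩
      ∣ ∁ p ∣       ≡⟨ ∣∁p∣≡n∸∣p∣ p ⟩
      _ ∸ ∣ p ∣     ∎)
    where
    open ≤-Reasoning
    q⊆∁p-x : q ⊆ ∁ p - x
    q⊆∁p-x y∈q = x∈p∧x≢y⇒x∈p-y (x∉p⇒x∈∁p (λ y∈p → disjoint y∈p y∈q)) (λ { refl → x∉q y∈q })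

  ∣insertAt∣ : ∀ (p : Subset n) i s → ∣ insertAt p i s ∣ ≡ ∣ s ∷ p ∣
  ∣insertAt∣ p             zero    s       = refl
  ∣insertAt∣ (outside ∷ p) (suc i) s       = ∣insertAt∣ p i s
  ∣insertAt∣ (inside  ∷ p) (suc i) inside  = cong suc (∣insertAt∣ p i inside)
  ∣insertAt∣ (inside  ∷ p) (suc i) outside = cong suc (∣insertAt∣ p i outside)

  punchIn∈insertAt : ∀ i s → x ∈ p → punchIn i x ∈ insertAt p i s
  punchIn∈insertAt {x = x} {p = p} i s x∈p =
    lookup⇒[]= (punchIn i x) _ (trans (insertAt-punchIn p i s x) ([]=⇒lookup x∈p))

  lookup-cong : x ∈ p ⇔ y ∈ q → lookup p x ≡ lookup q y
  lookup-cong {x = x} {p = p} {y = y} {q = q} x∈p⇔y∈q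
    with lookup p x in px | lookup q y in qy
  ... | inside  | inside  = refl
  ... | outside | outside = refl
  ... | inside  | outside =
    contradiction (trans (sym qy) ([]=⇒lookup (to x∈p⇔y∈q (lookup⇒[]= x p px)))) λ ()
  ... | outside | inside  =
    contradiction (trans (sym px) ([]=⇒lookup (from x∈p⇔y∈q (lookup⇒[]= y q qy)))) λ ()

  insertAt-restriction : ∀ i → (∀ z → punchIn i z ∈ p ⇔ z ∈ q) → insertAt q i (lookup p i) ≡ p
  insertAt-restriction {p = p} {q = q} i p∘punchIn≈q = begin
    insertAt q i (lookup p i)                    ≡⟨ tabulate∘lookup _ ⟨
    tabulate (lookup (insertAt q i (lookup p i))) ≡⟨ tabulate-cong pointwise ⟩
    tabulate (lookup p)                          ≡⟨ tabulate∘lookup p ⟩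
    p                                            ∎
    where
    open ≡-Reasoning
    pointwise : ∀ j → lookup (insertAt q i (lookup p i)) j ≡ lookup p j
    pointwise j with i ≟ j
    ... | yes refl = insertAt-lookup q i _
    ... | no  i≢j  = begin
      lookup r j                          ≡⟨ cong (lookup r) (punchIn-punchOut i≢j) ⟨
      lookup r (punchIn i (punchOut i≢j)) ≡⟨ insertAt-punchIn q i (lookup p i) (punchOut i≢j) ⟩
      lookup q (punchOut i≢j)             ≡⟨ lookup-cong (p∘punchIn≈q (punchOut i≢j)) ⟨
      lookup p (punchIn i (punchOut i≢j)) ≡⟨ cong (lookup p) (punchIn-punchOut i≢j) ⟩
      lookup p j                          ∎
      where r = insertAt q i (lookup p i)

  ∣p∣≡∣p[i]∷q∣ : ∀ i → (∀ z → punchIn i z ∈ p ⇔ z ∈ q) → ∣ p ∣ ≡ ∣ lookup p i ∷ q ∣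
  ∣p∣≡∣p[i]∷q∣ {p = p} {q = q} i p∘punchIn≈q =
    trans (cong ∣_∣ (sym (insertAt-restriction i p∘punchIn≈q))) (∣insertAt∣ q i (lookup p i))

module HeavyWeight where

  open import Data.Nat using (zero; _+_; _*_; _<_; s≤s)
  open import Data.Nat.Properties
  open import Function using (_∘_)
  open import Relation.Nullary using (¬_; Dec)
  import Relation.Nullary.Decidable as Dec

  record Heavy (Δ N k : ℕ) : Set where
    constructor mkHeavy
    field
      bound-violated : (Δ ∸ 1) * N < Δ * k

  Heavy? : ∀ Δ N k → Dec (Heavy Δ N k)
  Heavy? Δ N k = Dec.map′ mkHeavy Heavy.bound-violated ((Δ ∸ 1) * N <? Δ * k)

  ≤⇒¬Heavy : ∀ {Δ N k} → Δ * k ≤ (Δ ∸ 1) * N → ¬ Heavy Δ N k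
  ≤⇒¬Heavy ≤bound (mkHeavy >bound) = ≤⇒≯ ≤bound >bound

  ¬Heavy⇒≤ : ∀ {Δ N k} → ¬ Heavy Δ N k → Δ * k ≤ (Δ ∸ 1) * N
  ¬Heavy⇒≤ ¬heavy = ≮⇒≥ (¬heavy ∘ mkHeavy)

  Heavy-mono : ∀ {Δ N k k′} → k ≤ k′ → Heavy Δ N k → Heavy Δ N k′
  Heavy-mono {Δ} k≤k′ (mkHeavy >bound) = mkHeavy (<-≤-trans >bound (*-monoʳ-≤ Δ k≤k′))

  Heavy-suc : ∀ {Δ N k} → Heavy Δ N k → Heavy Δ (suc N) (suc k)
  Heavy-suc {Δ} {N} {k} (mkHeavy >bound) = mkHeavy (begin-strict
    (Δ ∸ 1) * suc N       ≡⟨ *-suc (Δ ∸ 1) N ⟩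
    Δ ∸ 1 + (Δ ∸ 1) * N   <⟨ +-mono-≤-< (m∸n≤m Δ 1) >bound ⟩
    Δ + Δ * k             ≡⟨ *-suc Δ k ⟨
    Δ * suc k             ∎)
    where open ≤-Reasoning

  Heavy-overlap : ∀ {Δ N k₁ k₂} → 2 ≤ Δ → Heavy Δ N k₁ → Heavy Δ N k₂ → N < k₁ + k₂
  Heavy-overlap {suc zero} (s≤s ())
  Heavy-overlap {suc (suc d)} {N} {k₁} {k₂} _ (mkHeavy >bound₁) (mkHeavy >bound₂) =
    ≰⇒> λ k₁+k₂≤N → <-irrefl refl (begin-strict
      suc d * N + suc d * N   <⟨ +-mono-< >bound₁ >bound₂ ⟩
      Δ * k₁ + Δ * k₂         ≡⟨ *-distribˡ-+ Δ k₁ k₂ ⟨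
      Δ * (k₁ + k₂)           ≤⟨ *-monoʳ-≤ Δ k₁+k₂≤N ⟩
      N + suc d * N           ≤⟨ +-monoˡ-≤ (suc d * N) (m≤m+n N (d * N)) ⟩
      suc d * N + suc d * N   ∎)
    where
    Δ = suc (suc d)
    open ≤-Reasoning

module Walks {n : ℕ} (G : Graph n) where

  open import Data.Fin using (_≟_)
  open import Data.List.Membership.Propositional using (_∈_; _∉_)
  open import Data.List.Relation.Binary.Subset.Propositional using (_⊆_)
  open import Data.List.Relation.Unary.All.Properties using (¬Any⇒All¬; All¬⇒¬Any)
  open import Data.List.Relation.Unary.All using ([])
  open import Data.List.Relation.Unary.AllPairs using ([]; _∷_)
  open import Data.List.Relation.Unary.Any using (here; there; any?)
  open import Data.Product using (Σ; _×_)
  open import Data.Sum using (_⊎_; inj₁; inj₂; [_,_])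
  open import Function using (_∘_; id)
  open import Function.Bundles using (_⇔_; mk⇔; Equivalence)
  open import Relation.Nullary using (yes; no)
  open import Relation.Binary.PropositionalEquality using (_≡_; _≢_)

  private variable
    a b c u v w z : Fin n

  _++_ : Walk G u v → Walk G v w → Walk G u w
  nil      ++ q = q
  cons e p ++ q = cons e (p ++ q)

  ∈-++⁻ : ∀ (p : Walk G u v) {q : Walk G v w} → c ∈ verts (p ++ q) → c ∈ verts p ⊎ c ∈ verts q
  ∈-++⁻ nil        c∈q         = inj₂ c∈q
  ∈-++⁻ (cons e p) (here refl) = inj₁ (here refl)
  ∈-++⁻ (cons e p) (there c∈)  = [ inj₁ ∘ there , inj₂ ] (∈-++⁻ p c∈)

  start∈ : (p : Walk G u v) → u ∈ verts p
  start∈ nil        = here refl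
  start∈ (cons _ _) = here refl

  end∈ : (p : Walk G u v) → v ∈ verts p
  end∈ nil        = here refl
  end∈ (cons _ p) = there (end∈ p)

  reverse : Walk G u v → Walk G v u
  reverse nil        = nil
  reverse (cons e p) = reverse p ++ cons (Graph.sym G e) nil

  ∈-reverse⁻ : (p : Walk G u v) → c ∈ verts (reverse p) → c ∈ verts p
  ∈-reverse⁻ nil        c∈ = c∈
  ∈-reverse⁻ (cons e p) c∈ with ∈-++⁻ (reverse p) c∈
  ... | inj₁ c∈p                = there (∈-reverse⁻ p c∈p)
  ... | inj₂ (here refl)        = there (start∈ p)
  ... | inj₂ (there (here refl)) = here refl

  len≤0⇒≡ : (p : Walk G u v) → len p ≤ 0 → u ≡ v
  len≤0⇒≡ nil _ = refl

  prefix : (p : Walk G u w) → c ∈ verts p → Σ (Walk G u c) λ q → verts q ⊆ verts p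
  prefix nil        (here refl) = nil , id
  prefix (cons e p) (here refl) = nil , λ { (here refl) → here refl }
  prefix (cons e p) (there c∈p) with prefix p c∈p
  ... | q , q⊆p = cons e q , λ { (here refl) → here refl ; (there d∈q) → there (q⊆p d∈q) }

  suffix : (p : Walk G u w) → c ∈ verts p →
           Σ (Walk G c w) λ q → verts q ⊆ verts p × (IsPath p → IsPath q)
  suffix nil        (here refl) = nil , id , id
  suffix (cons e p) (here refl) = cons e p , id , id
  suffix (cons e p) (there c∈p) with suffix p c∈p
  ... | q , q⊆p , path⇒path = q , there ∘ q⊆p , λ { (_ ∷ p-path) → path⇒path p-path }

  toPath : (p : Walk G u w) → Σ (Walk G u w) λ q → IsPath q × verts q ⊆ verts p
  toPath nil = nil , [] ∷ [] , id
  toPath (cons {u} e p) with toPath p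
  ... | q , q-path , q⊆p with any? (u ≟_) (verts q)
  ...   | yes u∈q = let r , r⊆q , path⇒path = suffix q u∈q
                    in r , path⇒path q-path , there ∘ q⊆p ∘ r⊆q
  ...   | no  u∉q = cons e q , ¬Any⇒All¬ (verts q) u∉q ∷ q-path ,
                    λ { (here refl) → here refl ; (there d∈q) → there (q⊆p d∈q) }

  AvoidingWalk : Fin n → Fin n → Fin n → Set
  AvoidingWalk a u v = Σ (Walk G u v) λ p → a ∉ verts p

  AvoidingWalk-sym : AvoidingWalk a u v → AvoidingWalk a v u
  AvoidingWalk-sym (p , a∉p) = reverse p , a∉p ∘ ∈-reverse⁻ p

  AvoidingWalk-trans : AvoidingWalk a u v → AvoidingWalk a v w → AvoidingWalk a u w
  AvoidingWalk-trans (p , a∉p) (q , a∉q) = p ++ q , [ a∉p , a∉q ] ∘ ∈-++⁻ p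

  AvoidingWalk-cons : a ≢ u → Adj G u v → AvoidingWalk a v w → AvoidingWalk a u w
  AvoidingWalk-cons a≢u e (p , a∉p) = cons e p , λ { (here a≡u) → a≢u a≡u ; (there a∈p) → a∉p a∈p }

  AvoidingWalk-prefix : ((p , _) : AvoidingWalk a u w) → c ∈ verts p → AvoidingWalk a u c
  AvoidingWalk-prefix (p , a∉p) c∈p with prefix p c∈p
  ... | q , q⊆p = q , a∉p ∘ q⊆p

  firstEdge⇔ : FirstEdge G a u z ⇔ (Adj G a u × AvoidingWalk a u z)
  firstEdge⇔ = mk⇔ to from
    where
    to : FirstEdge G a u z → Adj G a u × AvoidingWalk a u z
    to (cons e p , a∉p ∷ _ , refl) = e , p , All¬⇒¬Any a∉p
    from : Adj G a u × AvoidingWalk a u z → FirstEdge G a u z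
    from (e , p , a∉p) with toPath p
    ... | q , q-path , q⊆p = cons e q , ¬Any⇒All¬ (verts q) (a∉p ∘ q⊆p) ∷ q-path , refl

  firstEdge⇒adj : FirstEdge G a u z → Adj G a u
  firstEdge⇒adj (cons e _ , _ , refl) = e

  firstEdge⇒≢ : FirstEdge G a u z → a ≢ z
  firstEdge⇒≢ (cons e p , a∉p ∷ _ , refl) refl = All¬⇒¬Any a∉p (end∈ p)

  adj⇒firstEdge : Adj G a b → FirstEdge G a b b
  adj⇒firstEdge e = Equivalence.from firstEdge⇔ (e , nil , λ { (here refl) → Graph.irrefl G e })

module Trees {n : ℕ} (G : Graph n) where

  open Walks G
  open import Data.Fin using (_≟_)
  open import Data.List.Relation.Unary.All.Properties using (¬Any⇒All¬)
  open import Data.List.Relation.Unary.AllPairs using (_∷_)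
  open import Data.List.Relation.Unary.Any using (any?)
  open import Data.Nat using (s≤s)
  open import Data.Product using (∃)
  open import Function using (_∘_)
  open import Function.Bundles using (Equivalence)
  open import Relation.Nullary using (¬_; Dec; yes; no; contradiction)
  import Relation.Nullary.Decidable as Dec
  open import Relation.Binary.PropositionalEquality using (_≡_; _≢_; sym)

  open Equivalence using (to; from)

  private variable
    a b s u u′ z : Fin n

  module _ (acyclic : Acyclic G) where

    neighbours-separated : Adj G a u → Adj G a u′ → AvoidingWalk a u u′ → u ≡ u′
    neighbours-separated e e′ (p , a∉p) with toPath p
    ... | q , q-path , q⊆p
      with acyclic (Graph.sym G e′) (cons e q) (¬Any⇒All¬ (verts q) (a∉p ∘ q⊆p) ∷ q-path)
    ... | s≤s len-q≤0 = len≤0⇒≡ q len-q≤0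

    firstEdge-unique : FirstEdge G a u z → FirstEdge G a u′ z → u ≡ u′
    firstEdge-unique fe fe′ with to firstEdge⇔ fe | to firstEdge⇔ fe′
    ... | e , r | e′ , r′ = neighbours-separated e e′ (AvoidingWalk-trans r (AvoidingWalk-sym r′))

  firstEdge-exists : Connected G → a ≢ z → ∃ λ u → FirstEdge G a u z
  firstEdge-exists {a} {z} connected a≢z with connected a z
  ... | nil , _ = contradiction refl a≢z
  ... | cons {v = u} e p , path = u , cons e p , path , refl

  module _ (connected : Connected G) (acyclic : Acyclic G) where

    firstEdge? : ∀ a u z → Dec (FirstEdge G a u z)
    firstEdge? a u z with a ≟ z
    ... | yes refl = no λ fe → firstEdge⇒≢ fe refl
    ... | no a≢z with firstEdge-exists connected a≢z
    ... | u′ , fe′ with u′ ≟ u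
    ...   | yes refl = yes fe′
    ...   | no u′≢u  = no (u′≢u ∘ firstEdge-unique acyclic fe′)

    adj? : ∀ a b → Dec (Adj G a b)
    adj? a b = Dec.map′ firstEdge⇒adj adj⇒firstEdge (firstEdge? a b b)

    branches-cover : FirstEdge G a u b → FirstEdge G b s a → ¬ FirstEdge G b s z → FirstEdge G a u z
    branches-cover {a} {u} {b} {s} {z} fe-ab fe-ba ¬fe-bz with z ≟ b
    ... | yes refl = fe-ab
    ... | no z≢b with firstEdge-exists connected (z≢b ∘ sym)
    ... | s′ , fe-bz with s′ ≟ s
    ...   | yes refl = contradiction fe-bz ¬fe-bz
    ...   | no s′≢s with to firstEdge⇔ fe-ab | to firstEdge⇔ fe-ba | to firstEdge⇔ fe-bz
    ...     | e-au , r-ub | e-bs , r-sa | e-bs′ , r-s′z@(q , _) with any? (a ≟_) (verts q)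
    ...       | yes a∈q = contradiction (sym (neighbours-separated acyclic e-bs e-bs′
                  (AvoidingWalk-trans r-sa (AvoidingWalk-sym (AvoidingWalk-prefix r-s′z a∈q))))) s′≢s
    ...       | no  a∉q = from firstEdge⇔ (e-au , AvoidingWalk-trans r-ub
                  (AvoidingWalk-cons (firstEdge⇒≢ fe-ab) e-bs′ (q , a∉q)))

module LeafDeletion {m : ℕ} (T : Graph (suc m)) (x : Fin (suc m)) where

  open import Data.Fin using (_≟_; punchIn)
  open import Data.Fin.Properties using (punchIn-injective; punchInᵢ≢i; punchIn-punchOut)
  open import Data.List.Membership.Propositional using (_∈_; _∉_)
  import Data.List.Relation.Unary.All as All
  open import Data.List.Relation.Unary.AllPairs using (_∷_)
  open import Data.List.Relation.Unary.Any using (here; there)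
  open import Data.Product using (Σ)
  open import Function using (_∘_)
  open import Function.Bundles using (_⇔_; mk⇔; Equivalence)
  open import Relation.Nullary using (yes; no)
  open import Relation.Binary.PropositionalEquality using (_≡_; _≢_; sym; subst)

  open Walks T
  open Equivalence using (to; from)

  T′ : Graph m
  T′ = deleteVertex T x

  module W′ = Walks T′

  liftWalk : ∀ {a b} → Walk T′ a b → Walk T (punchIn x a) (punchIn x b)
  liftWalk nil        = nil
  liftWalk (cons e p) = cons e (liftWalk p)

  ∈-liftWalk⁻ : ∀ {a b c} (p : Walk T′ a b) → punchIn x c ∈ verts (liftWalk p) → c ∈ verts p
  ∈-liftWalk⁻ nil        (here eq)  = here (punchIn-injective x _ _ eq)
  ∈-liftWalk⁻ (cons e p) (here eq)  = here (punchIn-injective x _ _ eq)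
  ∈-liftWalk⁻ (cons e p) (there c∈) = there (∈-liftWalk⁻ p c∈)

  lowerWalk : ∀ {u w} (p : Walk T u w) → x ∉ verts p → ∀ {a b} → punchIn x a ≡ u → punchIn x b ≡ w →
              Σ (Walk T′ a b) λ q → ∀ {c} → c ∈ verts q → punchIn x c ∈ verts p
  lowerWalk nil x∉p {a} {b} refl πb≡πa with punchIn-injective x b a πb≡πa
  ... | refl = nil , λ { (here refl) → here refl }
  lowerWalk (cons {v = v} e p) x∉p refl refl =
    let q , q↑⊆p = lowerWalk p (x∉p ∘ there) (punchIn-punchOut x≢v) refl
    in  cons (subst (Adj T _) (sym (punchIn-punchOut x≢v)) e) q ,
        λ { (here refl) → here refl ; (there c∈q) → there (q↑⊆p c∈q) }
    where
    x≢v : x ≢ v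
    x≢v refl = x∉p (there (start∈ p))

  module _ (leaf : IsLeaf T x) where

    leaf-neighbour-unique : ∀ {a b} → Adj T x a → Adj T x b → a ≡ b
    leaf-neighbour-unique e e′ =
      let N , ∈N⇔adj , ∣N∣≡1 = leaf
      in  SubsetSize.∣p∣≡1⇒∈-unique ∣N∣≡1 (from (∈N⇔adj _) e) (from (∈N⇔adj _) e′)

    path-avoids-leaf : ∀ {a b} (p : Walk T a b) → IsPath p → a ≢ x → b ≢ x → x ∉ verts p
    path-avoids-leaf nil        _ a≢x _ (here refl) = a≢x refl
    path-avoids-leaf (cons e p) _ a≢x _ (here refl) = a≢x refl
    path-avoids-leaf (cons {v = v} e p) (a∉p ∷ p-path) a≢x b≢x (there x∈p) with v ≟ x
    ... | no v≢x = path-avoids-leaf p p-path v≢x b≢x x∈p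
    path-avoids-leaf (cons e nil)          _            a≢x b≢x _ | yes refl = b≢x refl
    path-avoids-leaf (cons e (cons e′ p′)) (a∉p ∷ _) a≢x b≢x _ | yes refl =
      All.lookup a∉p (there (start∈ p′)) (leaf-neighbour-unique (Graph.sym T e) e′)

    avoidingWalk-deleteVertex : ∀ {v y z} →
      W′.AvoidingWalk v y z ⇔ AvoidingWalk (punchIn x v) (punchIn x y) (punchIn x z)
    avoidingWalk-deleteVertex {v} {y} {z} = mk⇔
      (λ (p , v∉p) → liftWalk p , v∉p ∘ ∈-liftWalk⁻ p)
      λ (p , ↑v∉p) →
        let q , q-path , q⊆p = toPath p
            x∉q = path-avoids-leaf q q-path (punchInᵢ≢i x y) (punchInᵢ≢i x z)
            q′ , q′↑⊆q = lowerWalk q x∉q refl refl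
        in  q′ , ↑v∉p ∘ q⊆p ∘ q′↑⊆q

    firstEdge-deleteVertex : ∀ {v y z} →
      FirstEdge T′ v y z ⇔ FirstEdge T (punchIn x v) (punchIn x y) (punchIn x z)
    firstEdge-deleteVertex = mk⇔
      (λ fe → let e , r = to W′.firstEdge⇔ fe in from firstEdge⇔ (e , to avoidingWalk-deleteVertex r))
      (λ fe → let e , r = to firstEdge⇔ fe in from W′.firstEdge⇔ (e , from avoidingWalk-deleteVertex r))

module CoreAfterLeafDeletion
  {m : ℕ} (T : Graph (suc m)) (x : Fin (suc m))
  (connected : Connected T) (acyclic : Acyclic T) (leaf : IsLeaf T x)
  (Δ : ℕ) (2≤Δ : 2 ≤ Δ)
  where

  open import Data.Fin using (_≟_; punchIn)
  open import Data.Fin.Properties using (punchIn-punchOut; any?)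
  open import Data.Fin.Subset using (Subset; _∈_; _∉_; _⊆_; ∣_∣; inside; outside)
  open import Data.Fin.Subset.Properties using (p⊂q⇒∣p∣<∣q∣)
  open import Data.Nat.Properties using (<⇒≱; ≤-pred)
  open import Data.Product using (∃; _×_; proj₂)
  open import Data.Sum using (_⊎_; inj₁; inj₂)
  open import Data.Vec using (_∷_; lookup)
  open import Data.Vec.Properties using ([]=⇒lookup)
  open import Function using (_∘_)
  open import Function.Bundles using (_⇔_; mk⇔; Equivalence)
  open import Relation.Nullary using (¬_; yes; no; contradiction)
  open import Relation.Nullary.Decidable using (_×-dec_)
  import Relation.Nullary.Decidable as Dec
  open import Relation.Binary.PropositionalEquality using (_≡_; _≢_; sym; trans; subst)

  open SubsetSize
  open HeavyWeight
  open Walks T using (firstEdge⇒adj; firstEdge⇒≢)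
  open Trees T
  open LeafDeletion T x
  open Equivalence using (to; from)

  private variable
    a c u v z : Fin (suc m)
    S : Subset (suc m)

  Core : Fin (suc m) → Set
  Core = IsCore Δ T

  branch : Fin (suc m) → Fin (suc m) → Subset (suc m)
  branch a u = subsetOf (firstEdge? connected acyclic a u)

  ∈-branch : z ∈ branch a u ⇔ FirstEdge T a u z
  ∈-branch {a = a} {u = u} = ∈-subsetOf (firstEdge? connected acyclic a u)

  Card-branch : Card (FirstEdge T a u) ∣ branch a u ∣
  Card-branch {a = a} {u = u} = Card-subsetOf (firstEdge? connected acyclic a u)

  branch′ : Fin m → Fin m → Subset m
  branch′ v y = subsetOf λ z →
    Dec.map′ (from (firstEdge-deleteVertex leaf)) (to (firstEdge-deleteVertex leaf))
             (firstEdge? connected acyclic (punchIn x v) (punchIn x y) (punchIn x z))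

  ∈-branch⇔∈-branch′ : ∀ {v y} z → punchIn x z ∈ branch (punchIn x v) (punchIn x y) ⇔ z ∈ branch′ v y
  ∈-branch⇔∈-branch′ z = mk⇔
    (from (∈-subsetOf _) ∘ from (firstEdge-deleteVertex leaf) ∘ to ∈-branch)
    (from ∈-branch ∘ to (firstEdge-deleteVertex leaf) ∘ to (∈-subsetOf _))

  core⇒¬heavy : Core a → Adj T a u → ¬ Heavy Δ (suc m) ∣ branch a u ∣
  core⇒¬heavy core e = ≤⇒¬Heavy (core _ e _ Card-branch)

  core⇒¬heavy-⊂branch : Core a → Adj T a u → S ⊆ branch a u → c ∈ branch a u → c ∉ S →
                       ¬ Heavy Δ m ∣ S ∣
  core⇒¬heavy-⊂branch core e S⊆branch c∈branch c∉S heavy =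
    core⇒¬heavy core e (Heavy-mono (p⊂q⇒∣p∣<∣q∣ (S⊆branch , _ , c∈branch , c∉S)) (Heavy-suc heavy))

  HeavyBranch : Fin (suc m) → Fin (suc m) → Set
  HeavyBranch v u = Adj T v u × x ∉ branch v u × Heavy Δ m ∣ branch v u ∣

  leaf-branch : Adj T x u → x ≢ z → FirstEdge T x u z
  leaf-branch e x≢z =
    let _ , fe = firstEdge-exists connected x≢z
    in  subst (λ u → FirstEdge T x u _) (leaf-neighbour-unique leaf (firstEdge⇒adj fe) e) fe

  leaf-core⇒¬heavy : Core x → v ≢ x → ¬ HeavyBranch v u
  leaf-core⇒¬heavy {v} {u} core v≢x (_ , x∉B , heavy) =
    core⇒¬heavy-⊂branch core e (λ z∈B → from ∈-branch (leaf-branch e λ { refl → x∉B z∈B }))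
      (from ∈-branch fe) (λ v∈B → firstEdge⇒≢ (to ∈-branch v∈B) refl) heavy
    where
    fe = proj₂ (firstEdge-exists connected (v≢x ∘ sym))
    e = firstEdge⇒adj fe

  module _ {v₁ v₂ s₁₂ s₂₁ : Fin (suc m)}
           (fe₁₂ : FirstEdge T v₁ s₁₂ v₂) (fe₂₁ : FirstEdge T v₂ s₂₁ v₁) where

    branch-away⊆branch-toward : ∀ {u₁} → u₁ ≢ s₁₂ → branch v₁ u₁ ⊆ branch v₂ s₂₁
    branch-away⊆branch-toward u₁≢s₁₂ z∈B₁ = from ∈-branch
      (branches-cover connected acyclic fe₂₁ fe₁₂ (u₁≢s₁₂ ∘ firstEdge-unique acyclic (to ∈-branch z∈B₁)))

    heavy-away⇒¬heavy : ∀ {u₁ u₂} → Core v₂ → HeavyBranch v₁ u₁ → u₁ ≢ s₁₂ → ¬ HeavyBranch v₂ u₂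
    heavy-away⇒¬heavy {u₁} {u₂} core₂ (_ , x∉B₁ , heavy₁) u₁≢s₁₂ (e₂ , x∉B₂ , heavy₂) with u₂ ≟ s₂₁
    ... | yes refl = core⇒¬heavy-⊂branch core₂ e₂ B₁⊆B₂ (from ∈-branch fe₂₁)
                       (λ v₁∈B₁ → firstEdge⇒≢ (to ∈-branch v₁∈B₁) refl) heavy₁
      where B₁⊆B₂ = branch-away⊆branch-toward u₁≢s₁₂
    ... | no u₂≢s₂₁ =
      <⇒≱ (Heavy-overlap 2≤Δ heavy₂ heavy₁) (≤-pred (disjoint⇒∣q∣+∣p∣<n x∉B₁ x∉B₂ disjoint))
      where
      disjoint : ∀ {z} → z ∈ branch v₁ u₁ → z ∉ branch v₂ u₂
      disjoint z∈B₁ z∈B₂ = u₂≢s₂₁ (firstEdge-unique acyclic (to ∈-branch z∈B₂)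
                                     (to ∈-branch (branch-away⊆branch-toward u₁≢s₁₂ z∈B₁)))

  heavy-pair-impossible : ∀ {v₁ v₂ u₁ u₂} → v₁ ≢ v₂ → Core v₁ → Core v₂ →
                          HeavyBranch v₁ u₁ → ¬ HeavyBranch v₂ u₂
  heavy-pair-impossible {v₁} {v₂} {u₁} {u₂} v₁≢v₂ core₁ core₂ heavy₁ heavy₂
    with firstEdge-exists connected v₁≢v₂ | firstEdge-exists connected (v₁≢v₂ ∘ sym)
  ... | s₁₂ , fe₁₂ | s₂₁ , fe₂₁ with u₁ ≟ s₁₂ | u₂ ≟ s₂₁
  ...   | no u₁≢s₁₂ | _         = heavy-away⇒¬heavy fe₁₂ fe₂₁ core₂ heavy₁ u₁≢s₁₂ heavy₂
  ...   | yes _     | no u₂≢s₂₁ = heavy-away⇒¬heavy fe₂₁ fe₁₂ core₁ heavy₂ u₂≢s₂₁ heavy₁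
  -- Two heavy branches facing each other cover T, yet neither contains x.
  ...   | yes refl  | yes refl  =
    let (_ , x∉B₁ , _) = heavy₁ ; (_ , x∉B₂ , _) = heavy₂
    in  x∉B₁ (from ∈-branch (branches-cover connected acyclic fe₁₂ fe₂₁ (x∉B₂ ∘ from ∈-branch)))

  LeafOrHeavy : Fin (suc m) → Set
  LeafOrHeavy v = v ≡ x ⊎ ∃ (HeavyBranch v)

  LeafOrHeavy-unique : ∀ {v₁ v₂} → Core v₁ → Core v₂ → LeafOrHeavy v₁ → LeafOrHeavy v₂ → v₁ ≡ v₂
  LeafOrHeavy-unique {v₁} {v₂} core₁ core₂ lh₁ lh₂ with v₁ ≟ v₂
  ... | yes v₁≡v₂ = v₁≡v₂
  ... | no  v₁≢v₂ = contradiction (lh₁ , lh₂) impossible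
    where
    impossible : ¬ (LeafOrHeavy v₁ × LeafOrHeavy v₂)
    impossible (inj₁ refl       , inj₁ refl)       = v₁≢v₂ refl
    impossible (inj₁ refl       , inj₂ (_ , h₂))   = leaf-core⇒¬heavy core₁ (v₁≢v₂ ∘ sym) h₂
    impossible (inj₂ (_ , h₁)   , inj₁ refl)       = leaf-core⇒¬heavy core₂ v₁≢v₂ h₁
    impossible (inj₂ (_ , h₁)   , inj₂ (_ , h₂))   = heavy-pair-impossible v₁≢v₂ core₁ core₂ h₁ h₂

  core-lost⇒heavy : ∀ {z} → Core (punchIn x z) → ¬ IsCore Δ T′ z → ∃ (HeavyBranch (punchIn x z))
  core-lost⇒heavy {z} core ¬core′
    with any? (λ y → adj? connected acyclic (punchIn x z) (punchIn x y) ×-dec Heavy? Δ m ∣ branch′ z y ∣)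
  ... | no ∄heavy′ = contradiction core′ ¬core′
    where
    core′ : IsCore Δ T′ z
    core′ y e k card = ¬Heavy⇒≤ λ heavy′ →
      ∄heavy′ (y , e , subst (Heavy Δ m) (Card-unique card (Card-subsetOf _)) heavy′)
  ... | yes (y , e , heavy′) = weigh (∣p∣≡∣p[i]∷q∣ x ∈-branch⇔∈-branch′)
    where
    B = branch (punchIn x z) (punchIn x y)
    weigh : ∣ B ∣ ≡ ∣ lookup B x ∷ branch′ z y ∣ → ∃ (HeavyBranch (punchIn x z))
    weigh ∣B∣≡ with lookup B x in x∈?B
    ... | inside  =
      contradiction (subst (Heavy Δ (suc m)) (sym ∣B∣≡) (Heavy-suc heavy′)) (core⇒¬heavy core e)
    ... | outside = punchIn x y , e , (λ x∈B → contradiction (trans (sym x∈?B) ([]=⇒lookup x∈B)) λ ()) ,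
                    subst (Heavy Δ m) (sym ∣B∣≡) heavy′

  core-lost⇒LeafOrHeavy : Core v → (∀ z → punchIn x z ≡ v → ¬ IsCore Δ T′ z) → LeafOrHeavy v
  core-lost⇒LeafOrHeavy {v} core lost with v ≟ x
  ... | yes v≡x = inj₁ v≡x
  ... | no  v≢x = inj₂ (subst (∃ ∘ HeavyBranch) ↑z≡v
                         (core-lost⇒heavy (subst Core (sym ↑z≡v) core) (lost _ ↑z≡v)))
    where ↑z≡v = punchIn-punchOut (v≢x ∘ sym)

proposition2p2 : ∀ {m} (T : Graph (suc m)) (x : Fin (suc m)) (Δ : ℕ) →
    IsTree T → IsLeaf T x → 2 ≤ Δ →
    ∀ a b → Card (IsCore Δ T) a → Card (IsCore Δ (deleteVertex T x)) b →
    a ∸ 1 ≤ b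
proposition2p2 {m} T x Δ (connected , acyclic) leaf 2≤Δ _ _
               (S , ∈S⇔core , refl) (S′ , ∈S′⇔core′ , refl) =
  m≤n+o⇒m∸n≤o ∣ S ∣ 1
    (subst (λ k → ∣ S ∣ ≤ suc k) (∣insertAt∣ S′ x outside) (∣p∣≤1+∣q∣ lost-unique))
  where
  open import Data.Fin.Subset using (Subset; _∈_; _∉_; ∣_∣; outside)
  open import Data.Nat.Properties using (m≤n+o⇒m∸n≤o)
  open import Data.Vec using (insertAt)
  open import Function.Bundles using (Equivalence)
  open import Relation.Binary.PropositionalEquality using (_≡_; subst)
  open Equivalence using (to; from)
  open SubsetSize
  open CoreAfterLeafDeletion T x connected acyclic leaf Δ 2≤Δ

  S↑ : Subset (suc m)
  S↑ = insertAt S′ x outside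

  lost : ∀ {v} → v ∈ S → v ∉ S↑ → LeafOrHeavy v
  lost v∈S v∉S↑ = core-lost⇒LeafOrHeavy (to (∈S⇔core _) v∈S)
    λ z ↑z≡v core′ →
      v∉S↑ (subst (_∈ S↑) ↑z≡v (punchIn∈insertAt x outside (from (∈S′⇔core′ z) core′)))

  lost-unique : ∀ {v w} → v ∈ S → w ∈ S → v ∉ S↑ → w ∉ S↑ → v ≡ w
  lost-unique v∈S w∈S v∉S↑ w∉S↑ =
    LeafOrHeavy-unique (to (∈S⇔core _) v∈S) (to (∈S⇔core _) w∈S) (lost v∈S v∉S↑) (lost w∈S w∉S↑)
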